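{- For every odd integer $q\ge 3$ and all integers $s_1,\ldots,s_q\in\{q+2,q+3,\ldots,2q+2\}$, there exists a graph $G$ whose vertex set is the union of $q$ pairwise disjoint sets $V_1,\ldots,V_q$ such that: (i) $|V_i|=s_i$ for each $i\in[q]$; (ii) the edge set of $G$ can be partitioned into four sets $M_1,\ldots,M_4$ such that for every $1\le i<j\le q$ and every $k\in[4]$, the edges of $M_k$ with both endpoints in $V_i\cup V_j$ form a matching of size $q+1$; (iii) the chromatic number of $G$ is $q$ and the color classes of every proper $q$-coloring of $G$ are precisely the sets $V_1,\ldots,V_q$ (in particular each $V_i$ is independent).
   Context: $[q]=\{1,\ldots,q\}$. Graphs are finite and simple. -}

module Defs where

open import Data.Nat using (ℕ; _<_)
open import Data.Fin using (Fin)
open import Data.Product using (Σ; _×_; _,_; proj₁; proj₂; ∃)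
open import Data.Sum using (_⊎_)
open import Relation.Binary.PropositionalEquality using (_≡_; _≢_)
open import Relation.Nullary using (¬_)
open import Level using (suc; zero)

record Graph (V : Set) : Set₁ where
  field
    Adj    : V → V → Set
    sym    : ∀ {u v} → Adj u v → Adj v u
    irrefl : ∀ {v} → ¬ Adj v v
open Graph public

record EdgePartition4 {V : Set} (G : Graph V) : Set₁ where
  field
    M        : Fin 4 → V → V → Set
    M-sym    : ∀ k {u v} → M k u v → M k v u
    M-sub    : ∀ k {u v} → M k u v → Adj G u v
    M-cover  : ∀ {u v} → Adj G u v → Σ (Fin 4) (λ k → M k u v)
    M-disj   : ∀ {k l u v} → M k u v → M l u v → k ≡ l
open EdgePartition4 public

IsMatchingOfSize : {V : Set} → (V → V → Set) → ℕ → Set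
IsMatchingOfSize {V} E m =
  Σ (Fin m → V × V) λ f →
    (∀ t → E (proj₁ (f t)) (proj₂ (f t)))
    × (∀ t t' → t ≢ t' →
         (proj₁ (f t) ≢ proj₁ (f t')) × (proj₁ (f t) ≢ proj₂ (f t'))
         × (proj₂ (f t) ≢ proj₁ (f t')) × (proj₂ (f t) ≢ proj₂ (f t')))
    × (∀ u v → E u v → Σ (Fin m) λ t → (f t ≡ (u , v)) ⊎ (f t ≡ (v , u)))

IsProperColouring : {V : Set} → Graph V → (m : ℕ) → (V → Fin m) → Set
IsProperColouring G m c = ∀ {u v} → Adj G u v → c u ≢ c v

ChromaticNumberIs : {V : Set} → Graph V → ℕ → Set
ChromaticNumberIs {V} G q =
  Σ (V → Fin q) (IsProperColouring G q)
  × (∀ m → m < q → ¬ Σ (V → Fin m) (IsProperColouring G m))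

Vtx : (q : ℕ) → (Fin q → ℕ) → Set
Vtx q s = Σ (Fin q) (λ i → Fin (s i))

InParts : ∀ {q s} → Fin q → Fin q → Vtx q s → Set
InParts i j v = (proj₁ v ≡ i) ⊎ (proj₁ v ≡ j)

Restrict : ∀ {q s} → (Vtx q s → Vtx q s → Set) → Fin q → Fin q → Vtx q s → Vtx q s → Set
Restrict E i j u v = E u v × InParts i j u × InParts i j v

-- Number the vertices of a part of size 2 + e + q (0 ≤ e ≤ q) from 0. Between parts
-- V_i and V_j, i < j, of excesses e and f, the four matchings pair x ∈ V_i with
-- x ∈ V_j, x + 1 with x, and x with x + f + 1 (0 ≤ x ≤ q), and 0 with q + f + 1
-- together with x + e + 1 with x - 1 (1 ≤ x ≤ q). They are disjoint as soon as q ≥ 1.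
-- The vertices numbered 0 form a q-clique, so a proper q-colouring gives them q
-- distinct colours, one per part. Any other vertex a of V_i has, in each V_j with
-- j > i, a neighbour with a smaller number and, in each V_j with j < i, a neighbour
-- with number at most a. By induction on (number, part) every such neighbour has the
-- colour of the clique vertex of its part, so a avoids the colour of every other
-- part and is forced to take the colour of its own.
module Submission where

open import Data.Nat using (ℕ; zero; suc; _≟_; _+_; _*_; _≤_; _<_; _%_; z≤n; s≤s; s≤s⁻¹; z<s; s<s; s<s⁻¹; _≤?_; _<?_)
open import Data.Nat.Properties
open import Data.Nat.Induction using (<-wellFounded)
open import Data.Nat.Tactic.RingSolver using (solve-∀)
open import Data.Fin using (Fin; toℕ; fromℕ<; punchOut) renaming (_<_ to _<ᶠ_)
open import Data.Fin.Patterns using (0F; 1F; 2F; 3F)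
import Data.Fin.Properties as Fin
open import Data.Product using (Σ; ∃; ∃₂; _×_; _,_; proj₁; proj₂)
open import Data.Sum using (_⊎_; inj₁; inj₂)
open import Data.Empty using (⊥; ⊥-elim)
open import Defs hiding (sym)
open import Function.Bundles using (_⇔_; mk⇔)
open import Function.Definitions using (Injective)
open import Induction.WellFounded using (module All)
open import Relation.Binary.Construct.On as On using ()
open import Relation.Binary.Definitions using (tri<; tri≈; tri>)
open import Relation.Binary.PropositionalEquality using (_≡_; _≢_; refl; sym; trans; cong; subst)
open import Relation.Nullary using (¬_; yes; no)

injective⇒surjective : ∀ {n} {f : Fin n → Fin n} → Injective _≡_ _≡_ f → ∀ y → ∃ λ x → f x ≡ y
injective⇒surjective {suc m} {f} f-inj y with Fin.any? (λ x → f x Fin.≟ y)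
... | yes hit = hit
... | no miss = ⊥-elim (collision (Fin.pigeonhole (n<1+n m) (λ x → punchOut (missed x))))
  where
    missed : ∀ x → y ≢ f x
    missed x y≡fx = miss (x , sym y≡fx)
    collision : ¬ ∃₂ λ x x′ → x <ᶠ x′ × punchOut (missed x) ≡ punchOut (missed x′)
    collision (x , x′ , x<x′ , eq) =
      Fin.<-irrefl (f-inj (Fin.punchOut-injective (missed x) (missed x′) eq)) x<x′

lex-< : ∀ {q a b} i j → j < q → b < a → b * q + j < a * q + i
lex-< {q} {a} {b} i j j<q b<a = begin-strict
  b * q + j   <⟨ +-monoʳ-< (b * q) j<q ⟩
  b * q + q   ≡⟨ +-comm (b * q) q ⟩
  suc b * q   ≤⟨ *-monoˡ-≤ q b<a ⟩
  a * q       ≤⟨ m≤m+n (a * q) i ⟩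
  a * q + i   ∎
  where open ≤-Reasoning

ordered-in-pair : ∀ {q} {i j i′ j′ : Fin q} → i <ᶠ j → i′ <ᶠ j′ →
                  i′ ≡ i ⊎ i′ ≡ j → j′ ≡ i ⊎ j′ ≡ j → i′ ≡ i × j′ ≡ j
ordered-in-pair _   _     (inj₁ i′≡i)  (inj₂ j′≡j)  = i′≡i , j′≡j
ordered-in-pair _   i′<j′ (inj₁ refl) (inj₁ refl) = ⊥-elim (Fin.<-irrefl refl i′<j′)
ordered-in-pair i<j i′<j′ (inj₂ refl) (inj₁ refl) = ⊥-elim (Fin.<-asym i<j i′<j′)
ordered-in-pair _   i′<j′ (inj₂ refl) (inj₂ refl) = ⊥-elim (Fin.<-irrefl refl i′<j′)

excess-exists : ∀ q n → q + 2 ≤ n → n ≤ 2 * q + 2 → ∃ λ e → e ≤ q × n ≡ 2 + e + q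
excess-exists q n q+2≤n n≤2q+2 with m≤n⇒∃[o]m+o≡n q+2≤n
... | e , refl = e , +-cancelˡ-≤ (q + 2) e q (subst (q + 2 + e ≤_) (doubled q) n≤2q+2) , swapped q e
  where
    doubled : ∀ q → 2 * q + 2 ≡ q + 2 + q
    doubled = solve-∀
    swapped : ∀ q e → q + 2 + e ≡ 2 + e + q
    swapped = solve-∀

module Matchings (q : ℕ) where

  size : ℕ → ℕ
  size e = 2 + e + q

  lower : Fin 4 → ℕ → ℕ → ℕ
  lower 0F _ x       = x
  lower 1F _ x       = suc x
  lower 2F _ x       = x
  lower 3F _ zero    = zero
  lower 3F e (suc y) = 2 + e + y

  upper : Fin 4 → ℕ → ℕ → ℕ
  upper 0F _ x       = x
  upper 1F _ x       = x
  upper 2F f x       = suc f + x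
  upper 3F f zero    = suc f + q
  upper 3F _ (suc y) = y

  <size : ∀ e {x} → x < suc q → x < size e
  <size e x<1+q = s≤s (≤-trans (s≤s⁻¹ x<1+q) (m≤n+m q (suc e)))

  lower<size : ∀ k e {x} → x < suc q → lower k e x < size e
  lower<size 0F e         x<1+q = <size e x<1+q
  lower<size 1F e         x<1+q = s≤s (s≤s (≤-trans (s≤s⁻¹ x<1+q) (m≤n+m q e)))
  lower<size 2F e         x<1+q = <size e x<1+q
  lower<size 3F e {zero}  _     = z<s
  lower<size 3F e {suc y} y<q   = s<s (+-monoʳ-< (suc e) (s<s⁻¹ y<q))

  upper<size : ∀ k f {x} → x < suc q → upper k f x < size f
  upper<size 0F f         x<1+q = <size f x<1+q
  upper<size 1F f         x<1+q = <size f x<1+q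
  upper<size 2F f         x<1+q = s≤s (+-monoʳ-≤ (suc f) (s≤s⁻¹ x<1+q))
  upper<size 3F f {zero}  _     = n<1+n (suc f + q)
  upper<size 3F f {suc y} y<q   = <size f (<-trans (n<1+n y) y<q)

  lower-injective : ∀ k e {x x′} → lower k e x ≡ lower k e x′ → x ≡ x′
  lower-injective 0F _ eq = eq
  lower-injective 1F _ eq = suc-injective eq
  lower-injective 2F _ eq = eq
  lower-injective 3F _ {zero}  {zero}   _  = refl
  lower-injective 3F e {suc y} {suc y′} eq = cong suc (+-cancelˡ-≡ (suc e) y y′ (suc-injective eq))

  upper-injective : ∀ k f {x x′} → x < suc q → x′ < suc q → upper k f x ≡ upper k f x′ → x ≡ x′
  upper-injective 0F _ _ _ eq = eq
  upper-injective 1F _ _ _ eq = eq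
  upper-injective 2F f _ _ eq = +-cancelˡ-≡ (suc f) _ _ eq
  upper-injective 3F _ {zero}  {zero}   _     _     _  = refl
  upper-injective 3F f {zero}  {suc y′} _     y′<q eq =
    ⊥-elim (<-irrefl (sym eq) (<-≤-trans (s<s⁻¹ y′<q) (m≤n+m q (suc f))))
  upper-injective 3F f {suc y} {zero}   y<q   _     eq =
    ⊥-elim (<-irrefl eq (<-≤-trans (s<s⁻¹ y<q) (m≤n+m q (suc f))))
  upper-injective 3F _ {suc y} {suc y′} _     _     eq = cong suc eq

  private
    distinct-matchings-disjoint : 1 ≤ q → ∀ {k l} e f {x x′} → k <ᶠ l →
      lower k e x ≡ lower l e x′ → upper k f x ≡ upper l f x′ → ⊥
    distinct-matchings-disjoint _ {0F} {1F} _ _ _ A B = 1+n≢n (sym (trans (sym B) A))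
    distinct-matchings-disjoint _ {0F} {2F} _ _ _ A B = m≢1+n+m _ (trans (sym A) B)
    distinct-matchings-disjoint _ {0F} {3F} _ _ {x′ = zero}  _ refl ()
    distinct-matchings-disjoint _ {0F} {3F} _ _ {x′ = suc _} _ A refl = m≢1+n+m _ A
    distinct-matchings-disjoint _ {1F} {2F} _ _ _ A refl = m≢1+n+m _ (sym A)
    distinct-matchings-disjoint _ {1F} {3F} _ _ {x′ = zero}  _ () _
    distinct-matchings-disjoint _ {1F} {3F} _ _ {x′ = suc _} _ A refl = m≢1+n+m _ (suc-injective A)
    distinct-matchings-disjoint q≥1 {2F} {3F} _ f {x′ = zero} _ refl B =
      <-irrefl (+-cancelˡ-≡ (suc f) _ _ B) q≥1
    distinct-matchings-disjoint _ {2F} {3F} _ f {x′ = suc y} _ refl B =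
      <-irrefl (sym B) (<-≤-trans (m<n+m y z<s) (m≤n+m _ (suc f)))
    distinct-matchings-disjoint _ {1F} {1F} _ _ (s≤s ()) _ _
    distinct-matchings-disjoint _ {2F} {1F} _ _ (s≤s ()) _ _
    distinct-matchings-disjoint _ {2F} {2F} _ _ (s≤s (s≤s ())) _ _
    distinct-matchings-disjoint _ {3F} {1F} _ _ (s≤s ()) _ _
    distinct-matchings-disjoint _ {3F} {2F} _ _ (s≤s (s≤s ())) _ _
    distinct-matchings-disjoint _ {3F} {3F} _ _ (s≤s (s≤s (s≤s ()))) _ _

  matching-determined : 1 ≤ q → ∀ k l e f {x x′} →
    lower k e x ≡ lower l e x′ → upper k f x ≡ upper l f x′ → k ≡ l
  matching-determined q≥1 k l e f A B with Fin.<-cmp k l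
  ... | tri< k<l _ _ = ⊥-elim (distinct-matchings-disjoint q≥1 e f k<l A B)
  ... | tri≈ _ k≡l _ = k≡l
  ... | tri> _ _ l<k = ⊥-elim (distinct-matchings-disjoint q≥1 e f l<k (sym A) (sym B))

  lower-partner : ∀ e f {a} → e ≤ q → 0 < a → a < size e →
    Σ (Fin 4) λ k → Σ ℕ λ x → x < suc q × lower k e x ≡ a × upper k f x < a
  lower-partner e f {suc x} e≤q _ a<size with suc x ≤? suc q
  ... | yes x<1+q = 1F , x , x<1+q , refl , n<1+n x
  ... | no  x≮1+q with m≤n⇒∃[o]m+o≡n (≤-<-trans e≤q (s<s⁻¹ (≰⇒> x≮1+q)))
  ... | y , 1+e+y≡x =
    3F , suc y , s<s y<q , cong suc 1+e+y≡x , s≤s (subst (y ≤_) 1+e+y≡x (m≤n+m y (suc e)))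
    where
      y<q : y < q
      y<q = +-cancelˡ-< (suc e) y q (subst (_< suc e + q) (sym 1+e+y≡x) (s<s⁻¹ a<size))

  upper-partner : ∀ e f {b} → f ≤ q → b < size f →
    Σ (Fin 4) λ k → Σ ℕ λ x → x < suc q × upper k f x ≡ b × lower k e x ≤ b
  upper-partner e f {b} f≤q b<size with b <? suc q
  ... | yes b<1+q = 0F , b , b<1+q , refl , ≤-refl
  ... | no  b≮1+q with m≤n⇒∃[o]m+o≡n (≤-trans (s≤s f≤q) (≮⇒≥ b≮1+q))
  ... | x , 1+f+x≡b = 2F , x , s≤s x≤q , 1+f+x≡b , subst (x ≤_) 1+f+x≡b (m≤n+m x (suc f))
    where
      x≤q : x ≤ q
      x≤q = +-cancelˡ-≤ (suc f) x q (subst (_≤ suc f + q) (sym 1+f+x≡b) (s≤s⁻¹ b<size))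

module Construction (q : ℕ) (q≥1 : 1 ≤ q) (s e : Fin q → ℕ)
                    (e≤q : ∀ i → e i ≤ q) (s≡size : ∀ i → s i ≡ Matchings.size q (e i)) where
  open Matchings q

  V : Set
  V = Vtx q s

  edgeIndex : ∀ {x} → x < suc q → Fin (q + 1)
  edgeIndex {x} x<1+q = fromℕ< (subst (x <_) (+-comm 1 q) x<1+q)

  toℕ-edgeIndex : ∀ {x} (x<1+q : x < suc q) → toℕ (edgeIndex x<1+q) ≡ x
  toℕ-edgeIndex _ = Fin.toℕ-fromℕ< _

  toℕ<1+q : (t : Fin (q + 1)) → toℕ t < suc q
  toℕ<1+q t = subst (toℕ t <_) (+-comm q 1) (Fin.toℕ<n t)

  fromℕ<size : ∀ i {n} → n < size (e i) → Fin (s i)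
  fromℕ<size i {n} n<size = fromℕ< (subst (n <_) (sym (s≡size i)) n<size)

  toℕ-fromℕ<size : ∀ i {n} (n<size : n < size (e i)) → toℕ (fromℕ<size i n<size) ≡ n
  toℕ-fromℕ<size i _ = Fin.toℕ-fromℕ< _

  toℕ<size : ∀ i (a : Fin (s i)) → toℕ a < size (e i)
  toℕ<size i a = subst (toℕ a <_) (s≡size i) (Fin.toℕ<n a)

  lowerEnd : Fin 4 → (i : Fin q) → Fin (q + 1) → Fin (s i)
  lowerEnd k i t = fromℕ<size i (lower<size k (e i) (toℕ<1+q t))

  upperEnd : Fin 4 → (j : Fin q) → Fin (q + 1) → Fin (s j)
  upperEnd k j t = fromℕ<size j (upper<size k (e j) (toℕ<1+q t))

  toℕ-lowerEnd : ∀ k i t → toℕ (lowerEnd k i t) ≡ lower k (e i) (toℕ t)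
  toℕ-lowerEnd k i t = toℕ-fromℕ<size i (lower<size k (e i) (toℕ<1+q t))

  toℕ-upperEnd : ∀ k j t → toℕ (upperEnd k j t) ≡ upper k (e j) (toℕ t)
  toℕ-upperEnd k j t = toℕ-fromℕ<size j (upper<size k (e j) (toℕ<1+q t))

  toℕ-lowerEnd-at : ∀ k i {x} (x<1+q : x < suc q) → toℕ (lowerEnd k i (edgeIndex x<1+q)) ≡ lower k (e i) x
  toℕ-lowerEnd-at k i x<1+q = trans (toℕ-lowerEnd k i _) (cong (lower k (e i)) (toℕ-edgeIndex x<1+q))

  toℕ-upperEnd-at : ∀ k j {x} (x<1+q : x < suc q) → toℕ (upperEnd k j (edgeIndex x<1+q)) ≡ upper k (e j) x
  toℕ-upperEnd-at k j x<1+q = trans (toℕ-upperEnd k j _) (cong (upper k (e j)) (toℕ-edgeIndex x<1+q))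

  lowerEnd-at : ∀ k i {x} (x<1+q : x < suc q) {a} → lower k (e i) x ≡ toℕ a → lowerEnd k i (edgeIndex x<1+q) ≡ a
  lowerEnd-at k i x<1+q eq = Fin.toℕ-injective (trans (toℕ-lowerEnd-at k i x<1+q) eq)

  upperEnd-at : ∀ k j {x} (x<1+q : x < suc q) {b} → upper k (e j) x ≡ toℕ b → upperEnd k j (edgeIndex x<1+q) ≡ b
  upperEnd-at k j x<1+q eq = Fin.toℕ-injective (trans (toℕ-upperEnd-at k j x<1+q) eq)

  Link : Fin 4 → (i j : Fin q) → Fin (s i) → Fin (s j) → Set
  Link k i j a b = Σ (Fin (q + 1)) λ t → lowerEnd k i t ≡ a × upperEnd k j t ≡ b

  Mat : Fin 4 → V → V → Set
  Mat k (i , a) (j , b) = (i <ᶠ j × Link k i j a b) ⊎ (j <ᶠ i × Link k j i b a)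

  Mat-sym : ∀ k {u v} → Mat k u v → Mat k v u
  Mat-sym k (inj₁ m) = inj₂ m
  Mat-sym k (inj₂ m) = inj₁ m

  Edge : V → V → Set
  Edge u v = Σ (Fin 4) λ k → Mat k u v

  Edge-sym : ∀ {u v} → Edge u v → Edge v u
  Edge-sym (k , m) = k , Mat-sym k m

  Edge-irrefl : ∀ {v} → ¬ Edge v v
  Edge-irrefl (_ , inj₁ (i<i , _)) = Fin.<-irrefl refl i<i
  Edge-irrefl (_ , inj₂ (i<i , _)) = Fin.<-irrefl refl i<i

  G : Graph V
  G = record { Adj = Edge ; sym = Edge-sym ; irrefl = Edge-irrefl }

  Link-disjoint : ∀ {k l i j a b} → Link k i j a b → Link l i j a b → k ≡ l
  Link-disjoint {k} {l} {i} {j} (t , A , B) (t′ , A′ , B′) =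
    matching-determined q≥1 k l (e i) (e j) (same-value (toℕ-lowerEnd k i t) A (toℕ-lowerEnd l i t′) A′)
                                            (same-value (toℕ-upperEnd k j t) B (toℕ-upperEnd l j t′) B′)
    where
      same-value : ∀ {n} {c c′ : Fin n} {m m′ a} → toℕ c ≡ m → c ≡ a → toℕ c′ ≡ m′ → c′ ≡ a → m ≡ m′
      same-value refl refl refl refl = refl

  Mat-disjoint : ∀ {k l u v} → Mat k u v → Mat l u v → k ≡ l
  Mat-disjoint (inj₁ (_ , m))   (inj₁ (_ , m′))   = Link-disjoint m m′
  Mat-disjoint (inj₁ (i<j , _)) (inj₂ (j<i , _)) = ⊥-elim (Fin.<-asym i<j j<i)
  Mat-disjoint (inj₂ (j<i , _)) (inj₁ (i<j , _)) = ⊥-elim (Fin.<-asym i<j j<i)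
  Mat-disjoint (inj₂ (_ , m))   (inj₂ (_ , m′))   = Link-disjoint m m′

  P : EdgePartition4 G
  P = record { M = Mat ; M-sym = Mat-sym ; M-sub = λ k m → k , m ; M-cover = λ edge → edge ; M-disj = Mat-disjoint }

  position : V → ℕ
  position (_ , a) = toℕ a

  lowerEnd-injective : ∀ k i {t t′} → toℕ (lowerEnd k i t) ≡ toℕ (lowerEnd k i t′) → t ≡ t′
  lowerEnd-injective k i {t} {t′} eq = Fin.toℕ-injective (lower-injective k (e i)
    (trans (sym (toℕ-lowerEnd k i t)) (trans eq (toℕ-lowerEnd k i t′))))

  upperEnd-injective : ∀ k j {t t′} → toℕ (upperEnd k j t) ≡ toℕ (upperEnd k j t′) → t ≡ t′
  upperEnd-injective k j {t} {t′} eq = Fin.toℕ-injective (upper-injective k (e j) (toℕ<1+q t) (toℕ<1+q t′)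
    (trans (sym (toℕ-upperEnd k j t)) (trans eq (toℕ-upperEnd k j t′))))

  matchingEdge : (i j : Fin q) → Fin 4 → Fin (q + 1) → V × V
  matchingEdge i j k t = (i , lowerEnd k i t) , (j , upperEnd k j t)

  restricted-edge-listed : ∀ {i j} → i <ᶠ j → ∀ k u v → Restrict (Mat k) i j u v →
    Σ (Fin (q + 1)) λ t → (matchingEdge i j k t ≡ (u , v)) ⊎ (matchingEdge i j k t ≡ (v , u))
  restricted-edge-listed i<j k (i′ , _) (j′ , _) (inj₁ (i′<j′ , t , refl , refl) , u∈ij , v∈ij)
    with ordered-in-pair i<j i′<j′ u∈ij v∈ij
  ... | refl , refl = t , inj₁ refl
  restricted-edge-listed i<j k (i′ , _) (j′ , _) (inj₂ (j′<i′ , t , refl , refl) , u∈ij , v∈ij)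
    with ordered-in-pair i<j j′<i′ v∈ij u∈ij
  ... | refl , refl = t , inj₂ refl

  restriction-isMatching : ∀ {i j} → i <ᶠ j → ∀ k → IsMatchingOfSize (Restrict (Mat k) i j) (q + 1)
  restriction-isMatching {i} {j} i<j k =
    matchingEdge i j k
    , (λ t → inj₁ (i<j , t , refl , refl) , inj₁ refl , inj₂ refl)
    , (λ t t′ t≢t′ → (λ eq → t≢t′ (lowerEnd-injective k i (cong position eq)))
                     , (λ eq → Fin.<-irrefl (cong proj₁ eq) i<j)
                     , (λ eq → Fin.<-irrefl (sym (cong proj₁ eq)) i<j)
                     , (λ eq → t≢t′ (upperEnd-injective k j (cong position eq))))
    , restricted-edge-listed i<j k

  corner : Fin q → V
  corner i = i , fromℕ<size i z<s

  corner-edge : ∀ {i j} → i <ᶠ j → Edge (corner i) (corner j)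
  corner-edge {i} {j} i<j = 0F , inj₁ (i<j , edgeIndex z<s
    , lowerEnd-at 0F i z<s (sym (toℕ-fromℕ<size i z<s)) , upperEnd-at 0F j z<s (sym (toℕ-fromℕ<size j z<s)))

  corners-adjacent : ∀ {i j} → i ≢ j → Edge (corner i) (corner j)
  corners-adjacent {i} {j} i≢j with Fin.<-cmp i j
  ... | tri< i<j _ _ = corner-edge i<j
  ... | tri≈ _ i≡j _ = ⊥-elim (i≢j i≡j)
  ... | tri> _ _ j<i = Edge-sym (corner-edge j<i)

  part-colouring : IsProperColouring G q proj₁
  part-colouring (_ , inj₁ (i<j , _)) i≡j = Fin.<-irrefl i≡j i<j
  part-colouring (_ , inj₂ (j<i , _)) i≡j = Fin.<-irrefl (sym i≡j) j<i

  no-colouring-below-q : ∀ m → m < q → ¬ Σ (V → Fin m) (IsProperColouring G m)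
  no-colouring-below-q m m<q (c , proper) with Fin.pigeonhole m<q (λ i → c (corner i))
  ... | i , j , i<j , same-colour = proper (corner-edge i<j) same-colour

  rank : V → ℕ
  rank v = position v * q + toℕ (proj₁ v)

  earlier-neighbour : ∀ i (a : Fin (s i)) j → 0 < toℕ a → j ≢ i →
    Σ (Fin (s j)) λ b → Edge (i , a) (j , b) × rank (j , b) < rank (i , a)
  earlier-neighbour i a j a>0 j≢i with Fin.<-cmp i j
  ... | tri≈ _ i≡j _ = ⊥-elim (j≢i (sym i≡j))
  ... | tri< i<j _ _ with lower-partner (e i) (e j) (e≤q i) a>0 (toℕ<size i a)
  ...   | k , x , x<1+q , lower≡a , upper<a =
    upperEnd k j t , (k , inj₁ (i<j , t , lowerEnd-at k i x<1+q lower≡a , refl)) ,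
    lex-< (toℕ i) (toℕ j) (Fin.toℕ<n j) (subst (_< toℕ a) (sym (toℕ-upperEnd-at k j x<1+q)) upper<a)
    where t = edgeIndex x<1+q
  earlier-neighbour i a j a>0 j≢i | tri> _ _ j<i with upper-partner (e j) (e i) (e≤q i) (toℕ<size i a)
  ...   | k , x , x<1+q , upper≡a , lower≤a =
    b , (k , inj₂ (j<i , t , refl , upperEnd-at k i x<1+q upper≡a)) , earlier (m≤n⇒m<n∨m≡n b≤a)
    where
      t = edgeIndex x<1+q
      b = lowerEnd k j t
      b≤a : toℕ b ≤ toℕ a
      b≤a = subst (_≤ toℕ a) (sym (toℕ-lowerEnd-at k j x<1+q)) lower≤a
      earlier : toℕ b < toℕ a ⊎ toℕ b ≡ toℕ a → rank (j , b) < rank (i , a)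
      earlier (inj₁ b<a) = lex-< (toℕ i) (toℕ j) (Fin.toℕ<n j) b<a
      earlier (inj₂ b≡a) rewrite b≡a = +-monoʳ-< (toℕ a * q) j<i

  module _ (c : V → Fin q) (proper : IsProperColouring G q c) where

    cornerColour : Fin q → Fin q
    cornerColour i = c (corner i)

    cornerColour-injective : Injective _≡_ _≡_ cornerColour
    cornerColour-injective {i} {j} same with i Fin.≟ j
    ... | yes i≡j = i≡j
    ... | no  i≢j = ⊥-elim (proper (corners-adjacent i≢j) same)

    forced-colour : ∀ i y → (∀ j → j ≢ i → y ≢ cornerColour j) → y ≡ cornerColour i
    forced-colour i y avoids with injective⇒surjective cornerColour-injective y
    ... | j , cj≡y with j Fin.≟ i
    ...   | yes refl = sym cj≡y
    ...   | no  j≢i  = ⊥-elim (avoids j j≢i (sym cj≡y))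

    colour≡cornerColour : ∀ v → c v ≡ cornerColour (proj₁ v)
    colour≡cornerColour = All.wfRec (On.wellFounded rank <-wellFounded) _ _ step
      where
        step : ∀ v → (∀ {w} → rank w < rank v → c w ≡ cornerColour (proj₁ w)) → c v ≡ cornerColour (proj₁ v)
        step (i , a) earlier-ok with toℕ a ≟ 0
        ... | yes a≡0 = cong (λ b → c (i , b)) (Fin.toℕ-injective (trans a≡0 (sym (toℕ-fromℕ<size i z<s))))
        ... | no  a≢0 = forced-colour i (c (i , a)) avoids
          where
            avoids : ∀ j → j ≢ i → c (i , a) ≢ cornerColour j
            avoids j j≢i same with earlier-neighbour i a j (n≢0⇒n>0 a≢0) j≢i
            ... | _ , edge , earlier = proper edge (trans same (sym (earlier-ok earlier)))

    colour-classes-are-parts : ∀ u v → (c u ≡ c v) ⇔ (proj₁ u ≡ proj₁ v)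
    colour-classes-are-parts u v = mk⇔
      (λ same → cornerColour-injective
        (trans (sym (colour≡cornerColour u)) (trans same (colour≡cornerColour v))))
      (λ same-part → trans (colour≡cornerColour u)
        (trans (cong cornerColour same-part) (sym (colour≡cornerColour v))))

lemma4 : (q : ℕ) → 3 ≤ q → q % 2 ≡ 1 →
    (s : Fin q → ℕ) → (∀ i → q + 2 ≤ s i × s i ≤ 2 * q + 2) →
    Σ (Graph (Vtx q s)) λ G →
      Σ (EdgePartition4 G) (λ P →
          ∀ (i j : Fin q) → i <ᶠ j → ∀ (k : Fin 4) →
            IsMatchingOfSize (Restrict (M P k) i j) (q + 1))
      × ChromaticNumberIs G q
      × (∀ (c : Vtx q s → Fin q) → IsProperColouring G q c →
           ∀ u v → (c u ≡ c v) ⇔ (proj₁ u ≡ proj₁ v))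
lemma4 q 3≤q _ s s-bounds =
  G , (P , λ _ _ → restriction-isMatching) , ((proj₁ , part-colouring) , no-colouring-below-q) , colour-classes-are-parts
  where
    excess : ∀ i → ∃ λ e → e ≤ q × s i ≡ 2 + e + q
    excess i = excess-exists q (s i) (proj₁ (s-bounds i)) (proj₂ (s-bounds i))

    open Construction q (≤-trans (s≤s z≤n) 3≤q) s (λ i → proj₁ (excess i))
                      (λ i → proj₁ (proj₂ (excess i))) (λ i → proj₂ (proj₂ (excess i)))
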